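{- Let $n=kt$ and let $\gamma\in\mathbb{F}_{q^n}$ satisfy $\mathbb{F}_{q^k}(\gamma)=\mathbb{F}_{q^n}$. Let $l$ be a nonnegative integer with $l<t-1$ and let \[U=\mathbb{F}_{q^k}+\gamma\mathbb{F}_{q^k}+\cdots+\gamma^{l}\mathbb{F}_{q^k}.\] Then $H(U)=\mathbb{F}_{q^k}$.
   Context: For an $\mathbb{F}_q$-subspace $W$ of $\mathbb{F}_{q^n}$, its stabilizer is $H(W)=\{x\in\mathbb{F}_{q^n}^*: xW=W\}\cup\{0\}$. -}

module Defs where

open import Level using (Level; _⊔_)
open import Algebra.Bundles using (CommutativeRing; Semiring)
open import Data.Nat using (ℕ; suc) renaming (_^_ to _^ℕ_)
open import Data.Fin using (Fin; toℕ)
open import Data.Product using (Σ; ∃; _×_)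
open import Data.Sum using (_⊎_)
open import Relation.Nullary using (¬_)
open import Relation.Unary using (Pred)
open import Function.Bundles using (Inverse)
import Relation.Binary.PropositionalEquality as ≡

-- Everything is relative to a commutative ring R (with setoid equality ≈),
-- which will be assumed to be a field with q^n elements, i.e. F_{q^n}.
module FF {c ℓ : Level} (R : CommutativeRing c ℓ) where
  open CommutativeRing R
  open import Algebra.Definitions.RawSemiring (Semiring.rawSemiring semiring)
    using (sum) renaming (_^_ to _^ᴿ_)

  IsField : Set (c ⊔ ℓ)
  IsField = (¬ (1# ≈ 0#)) × (∀ x → ¬ (x ≈ 0#) → ∃ λ y → (x * y) ≈ 1#)

  HasCard : ℕ → Set (c ⊔ ℓ)
  HasCard N = Inverse setoid (≡.setoid (Fin N))

  record IsSubfield (P : Pred Carrier (c ⊔ ℓ)) : Set (c ⊔ ℓ) where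
    field
      resp  : ∀ {x y} → x ≈ y → P x → P y
      has0  : P 0#
      has1  : P 1#
      closed+ : ∀ {x y} → P x → P y → P (x + y)
      closed- : ∀ {x} → P x → P (- x)
      closed* : ∀ {x y} → P x → P y → P (x * y)
      closedInv : ∀ {x y} → P x → (x * y) ≈ 1# → P y

  -- the subfield F_{q^k} of F_{q^n}: the elements with x^(q^k) = x
  Fqk : ℕ → ℕ → Pred Carrier ℓ
  Fqk q k x = (x ^ᴿ (q ^ℕ k)) ≈ x

  -- K(γ) = whole field: every subfield containing K and γ is everything
  GeneratesOver : Pred Carrier ℓ → Carrier → Set (Level.suc (c ⊔ ℓ))
  GeneratesOver K γ =
    (P : Pred Carrier (c ⊔ ℓ)) → IsSubfield P → (∀ x → K x → P x) → P γ →
    ∀ x → P x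

  PowSpan : Pred Carrier ℓ → Carrier → ℕ → Pred Carrier (c ⊔ ℓ)
  PowSpan K γ l x =
    Σ (Fin (suc l) → Carrier) λ a →
      (∀ i → K (a i)) × (x ≈ sum (λ i → a i * (γ ^ᴿ toℕ i)))

  Stab : Pred Carrier (c ⊔ ℓ) → Pred Carrier (c ⊔ ℓ)
  Stab W x =
    (x ≈ 0#) ⊎
    ((¬ (x ≈ 0#)) ×
     ((∀ w → W w → W (x * w)) × (∀ w → W w → ∃ λ v → W v × (w ≈ (x * v)))))

{-# OPTIONS --safe #-}
-- H(U) is a field containing K = 𝔽_{q^k}, so the point is H(U) ⊆ K. Put U_j = K + γK + ⋯ + γ^j K.
-- If γ U_j ⊆ U_j, then U_j is closed under products, hence a subfield (inverses are powers in a
-- finite field) containing K and γ, hence everything; but |U_j| ≤ |K|^(j+1) ≤ q^(k(j+1)) < q^(kt)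
-- when j + 1 < t. So U = U_l is not γ-stable. If x U ⊆ U then x = x·1 ∈ U, and whenever
-- x = y + γ^(m+1) b with y ∈ U_m, b ≠ 0, m < l, the element x γ^(l−m) − γ^(l−m) y = γ^(l+1) b
-- lies in U, which would make U γ-stable; descending in m gives x ∈ U_0 = K.
-- That K is a subfield at all rests on Frobenius: |F| = p^a (F is a vector space over 𝔽_p), so
-- q^k, which divides |F|, is a power of the characteristic p.
module Submission where

open import Level using (_⊔_)
open import Algebra.Bundles using (CommutativeRing; Semiring)
open import Data.Empty using (⊥; ⊥-elim)
open import Data.Fin as Fin using (Fin; toℕ)
import Data.Fin.Properties as Fin
open import Data.List using (List; []; _∷_; length; replicate)
open import Data.List.Properties using (length-replicate)
open import Data.Nat as ℕ using (ℕ; zero; suc; z≤n; s≤s; _!)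
open import Data.Nat.Combinatorics using (_C_; nCn≡1; k![n∸k]!∣n!)
open import Data.Nat.Combinatorics.Specification using (nCk≡n!/k![n-k]!)
open import Data.Nat.DivMod using (_%_; _/_; m≡m%n+[m/n]*n; m%n<n; m/n*n≡m)
import Data.Nat.Properties as ℕ
open import Data.Nat.Divisibility using (_∣_; divides; _∣?_; ∣⇒≤; ∣1⇒≡1; m∣m*n; *-cancelˡ-∣)
open import Data.Nat.Coprimality using (Coprime; coprime-divisor)
open import Data.Nat.Primality using (Irreducible; irreducible⇒nonZero)
open import Data.Product using (∃; _×_; _,_; proj₁; proj₂)
open import Data.Sum using (_⊎_; inj₁; inj₂)
open import Data.Unit.Polymorphic using (⊤)
open import Relation.Binary.Definitions using (tri<; tri≈; tri>)
open import Function.Base using (_∘_)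
open import Function.Bundles using (Inverse; _⇔_; mk⇔)
open import Function.Definitions using (Injective)
open import Relation.Binary.PropositionalEquality as ≡ using (_≡_; _≢_)
open import Relation.Nullary using (¬_; ¬?; Dec; yes; no)
open import Relation.Nullary.Decidable using (decidable-stable; map′)
open import Relation.Unary using (Pred; Decidable)

open import Defs

record Enumeration {n p} (P : Pred (Fin n) p) : Set p where
  field
    size      : ℕ
    index     : Fin size → Fin n
    injective : Injective _≡_ _≡_ index
    sound     : ∀ i → P (index i)
    complete  : ∀ j → P j → ∃ λ i → index i ≡ j

enumerate : ∀ {n p} {P : Pred (Fin n) p} → Decidable P → Enumeration P
enumerate {zero} P? = record
  { size = 0 ; index = λ () ; injective = λ { {()} } ; sound = λ () ; complete = λ () }
enumerate {suc n} {P = P} P? with enumerate (P? ∘ Fin.suc) | P? Fin.zero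
... | e | no ¬P0 = record
  { size      = size
  ; index     = Fin.suc ∘ index
  ; injective = injective ∘ Fin.suc-injective
  ; sound     = sound
  ; complete  = complete′
  }
  where
  open Enumeration e
  complete′ : ∀ j → P j → ∃ λ i → Fin.suc (index i) ≡ j
  complete′ Fin.zero    P0 = ⊥-elim (¬P0 P0)
  complete′ (Fin.suc j) Pj = let i , eq = complete j Pj in i , ≡.cong Fin.suc eq
... | e | yes P0 = record
  { size      = suc size
  ; index     = index′
  ; injective = injective′
  ; sound     = sound′
  ; complete  = complete′
  }
  where
  open Enumeration e
  index′ : Fin (suc size) → Fin (suc n)
  index′ Fin.zero    = Fin.zero
  index′ (Fin.suc i) = Fin.suc (index i)
  injective′ : Injective _≡_ _≡_ index′
  injective′ {Fin.zero}  {Fin.zero}  _  = ≡.refl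
  injective′ {Fin.suc i} {Fin.suc j} eq = ≡.cong Fin.suc (injective (Fin.suc-injective eq))
  sound′ : ∀ i → P (index′ i)
  sound′ Fin.zero    = P0
  sound′ (Fin.suc i) = sound i
  complete′ : ∀ j → P j → ∃ λ i → index′ i ≡ j
  complete′ Fin.zero    _  = Fin.zero , ≡.refl
  complete′ (Fin.suc j) Pj = let i , eq = complete j Pj in Fin.suc i , ≡.cong Fin.suc eq

∣p^a⇒≡p^e : ∀ {p} → Irreducible p → ∀ a {d} → d ∣ p ℕ.^ a → ∃ λ e → d ≡ p ℕ.^ e
∣p^a⇒≡p^e irr zero    d∣1 = 0 , ∣1⇒≡1 d∣1
∣p^a⇒≡p^e {p} irr (suc a) {d} d∣p^[1+a] with p ∣? d
... | yes (divides d′ d≡d′*p) =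
  let e , d′≡p^e = ∣p^a⇒≡p^e irr a (*-cancelˡ-∣ p (≡.subst (_∣ p ℕ.^ suc a) d≡p*d′ d∣p^[1+a]))
  in suc e , ≡.trans d≡p*d′ (≡.cong (p ℕ.*_) d′≡p^e)
  where
  instance _ = irreducible⇒nonZero irr
  d≡p*d′ : d ≡ p ℕ.* d′
  d≡p*d′ = ≡.trans d≡d′*p (ℕ.*-comm d′ p)
... | no p∤d = ∣p^a⇒≡p^e irr a (coprime-divisor d⊥p d∣p^[1+a])
  where
  d⊥p : Coprime d p
  d⊥p (i∣d , i∣p) with irr i∣p
  ... | inj₁ i≡1 = i≡1
  ... | inj₂ i≡p = ⊥-elim (p∤d (≡.subst (_∣ d) i≡p i∣d))

<∸1⇒suc< : ∀ {m n} → m ℕ.< n ℕ.∸ 1 → suc m ℕ.< n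
<∸1⇒suc< {n = suc n} m<n = s≤s m<n

module MonicPolynomial {c ℓ} (R : CommutativeRing c ℓ) where
  open CommutativeRing R renaming (Carrier to A)
  open import Relation.Binary.Reasoning.Setoid setoid
  open import Algebra.Solver.Ring.NaturalCoefficients.Default commutativeSemiring

  -- A list [a₀, …, a_{n-1}] stands for the monic polynomial a₀ + a₁X + ⋯ + a_{n-1}X^{n-1} + X^n.
  eval : List A → A → A
  eval []       x = 1#
  eval (a ∷ as) x = a + x * eval as x

  quotientBy : A → List A → List A
  quotientBy r []       = []
  quotientBy r (b ∷ bs) = eval (b ∷ bs) r ∷ quotientBy r bs

  length-quotientBy : ∀ r as → length (quotientBy r as) ≡ length as
  length-quotientBy r []       = ≡.refl
  length-quotientBy r (b ∷ bs) = ≡.cong suc (length-quotientBy r bs)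

  x≈[x-r]+r : ∀ x r → x ≈ (x - r) + r
  x≈[x-r]+r x r = sym (begin
    (x - r) + r   ≈⟨ +-assoc x (- r) r ⟩
    x + (- r + r) ≈⟨ +-congˡ (-‿inverseˡ r) ⟩
    x + 0#        ≈⟨ +-identityʳ x ⟩
    x             ∎)

  division : ∀ r a as x → eval (a ∷ as) x ≈ (x - r) * eval (quotientBy r as) x + eval (a ∷ as) r
  division r a [] x = begin
    a + x * 1#                    ≈⟨ +-congˡ (*-congʳ (x≈[x-r]+r x r)) ⟩
    a + ((x - r) + r) * 1#        ≈⟨ solve 3 (λ a d r → a :+ (d :+ r) :* con 1 := d :* con 1 :+ (a :+ r :* con 1)) refl a (x - r) r ⟩
    (x - r) * 1# + (a + r * 1#)   ∎
  division r a (b ∷ bs) x = begin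
    a + x * eval (b ∷ bs) x
      ≈⟨ +-congˡ (*-cong (x≈[x-r]+r x r) (division r b bs x)) ⟩
    a + ((x - r) + r) * ((x - r) * eval (quotientBy r bs) x + eval (b ∷ bs) r)
      ≈⟨ solve 5 (λ a d r g e → a :+ (d :+ r) :* (d :* g :+ e) := d :* (e :+ (d :+ r) :* g) :+ (a :+ r :* e)) refl
           a (x - r) r (eval (quotientBy r bs) x) (eval (b ∷ bs) r) ⟩
    (x - r) * (eval (b ∷ bs) r + ((x - r) + r) * eval (quotientBy r bs) x) + (a + r * eval (b ∷ bs) r)
      ≈⟨ +-congʳ (*-congˡ (+-congˡ (*-congʳ (sym (x≈[x-r]+r x r))))) ⟩
    (x - r) * eval (quotientBy r (b ∷ bs)) x + eval (a ∷ b ∷ bs) r ∎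

  module _ (1≉0 : 1# ≉ 0#) (zero-product : ∀ {a b} → a * b ≈ 0# → a ≈ 0# ⊎ b ≈ 0#) where

    roots≤degree : ∀ {m} as (rs : Fin m → A) → Injective _≡_ _≈_ rs →
                   (∀ i → eval as (rs i) ≈ 0#) → m ℕ.≤ length as
    roots≤degree {zero}  as       rs _   _    = z≤n
    roots≤degree {suc m} []       rs _   root = ⊥-elim (1≉0 (root Fin.zero))
    roots≤degree {suc m} (a ∷ as) rs inj root =
      s≤s (≡.subst (m ℕ.≤_) (length-quotientBy r as)
            (roots≤degree (quotientBy r as) (rs ∘ Fin.suc) (Fin.suc-injective ∘ inj) quotient-root))
      where
      r = rs Fin.zero
      quotient-root : ∀ i → eval (quotientBy r as) (rs (Fin.suc i)) ≈ 0#
      quotient-root i with zero-product (begin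
        (x - r) * eval (quotientBy r as) x                  ≈⟨ +-identityʳ _ ⟨
        (x - r) * eval (quotientBy r as) x + 0#             ≈⟨ +-congˡ (root Fin.zero) ⟨
        (x - r) * eval (quotientBy r as) x + eval (a ∷ as) r ≈⟨ division r a as x ⟨
        eval (a ∷ as) x                                     ≈⟨ root (Fin.suc i) ⟩
        0#                                                  ∎)
        where x = rs (Fin.suc i)
      ... | inj₂ q[x]≈0 = q[x]≈0
      ... | inj₁ x-r≈0 with inj {Fin.suc i} {Fin.zero}
                             (trans (x≈[x-r]+r _ r) (trans (+-congʳ x-r≈0) (+-identityˡ r)))
      ... | ()

module FiniteField {c ℓ} (R : CommutativeRing c ℓ) {N : ℕ}
                   (isField : FF.IsField R) (card : FF.HasCard R N) where
  open CommutativeRing R renaming (Carrier to F)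
  open import Relation.Binary.Reasoning.Setoid setoid
  open import Algebra.Properties.Semiring.Exp semiring using (_^_; ^-congˡ; ^-congʳ; ^-homo-*; ^-assocʳ)
  open import Algebra.Properties.CommutativeSemiring.Exp commutativeSemiring using (^-distrib-*)
  open import Algebra.Properties.Semiring.Mult semiring
    using (×-homo-1; ×-homo-+; ×1-homo-*; ×-assoc-*; ×-congʳ) renaming (_×_ to _⨰_)
  open import Algebra.Properties.Ring ring using (-1*x≈-x)
  open import Algebra.Properties.AbelianGroup +-abelianGroup using (xyx⁻¹≈y)
  open import Algebra.Properties.Group +-group using () renaming (∙-cancelˡ to +-cancelˡ)
  open import Algebra.Definitions.RawSemiring (Semiring.rawSemiring semiring) using (sum)
  open import Algebra.Properties.Semiring.Sum semiring using (sum-cong-≋; *-distribˡ-sum)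
  import Algebra.Properties.CommutativeSemiring.Binomial commutativeSemiring as Binomial
  open import Algebra.Properties.CommutativeSemigroup +-commutativeSemigroup
    using () renaming (interchange to +-interchange)
  open import Algebra.Properties.CommutativeSemigroup *-commutativeSemigroup using (x∙yz≈y∙xz)
  open import Algebra.Solver.Ring.NaturalCoefficients.Default commutativeSemiring using (solve; _:=_; _:*_; _:+_)
  open Inverse card using (to; from; to-cong; inverseˡ; inverseʳ)

  to-injective : ∀ {x y} → to x ≡ to y → x ≈ y
  to-injective {x} {y} eq = begin
    x            ≈⟨ inverseʳ ≡.refl ⟨
    from (to x)  ≡⟨ ≡.cong from eq ⟩
    from (to y)  ≈⟨ inverseʳ ≡.refl ⟩
    y            ∎

  from-injective : ∀ {i j} → from i ≈ from j → i ≡ j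
  from-injective {i} {j} eq = ≡.trans (≡.sym (inverseˡ refl)) (≡.trans (to-cong eq) (inverseˡ refl))

  infix 4 _≟_
  _≟_ : (x y : F) → Dec (x ≈ y)
  x ≟ y with to x Fin.≟ to y
  ... | yes eq = yes (to-injective eq)
  ... | no  ne = no (ne ∘ to-cong)

  injective⇒≤N : ∀ {a} {f : Fin a → F} → Injective _≡_ _≈_ f → a ℕ.≤ N
  injective⇒≤N inj = Fin.injective⇒≤ (inj ∘ to-injective)

  surjective⇒N≤ : ∀ {a} (f : Fin a → F) → (∀ z → ∃ λ i → f i ≈ z) → N ℕ.≤ a
  surjective⇒N≤ f surj = Fin.injective⇒≤ {f = λ n → proj₁ (surj (from n))} λ {m} {n} eq →
    from-injective (trans (sym (proj₂ (surj (from m)))) (trans (reflexive (≡.cong f eq)) (proj₂ (surj (from n)))))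

  1≉0 : 1# ≉ 0#
  1≉0 = proj₁ isField

  *-inverse : ∀ {x} → x ≉ 0# → ∃ λ y → x * y ≈ 1#
  *-inverse = proj₂ isField _

  inverse-unique : ∀ {x y y′} → x * y ≈ 1# → x * y′ ≈ 1# → y ≈ y′
  inverse-unique {x} {y} {y′} xy≈1 xy′≈1 = begin
    y             ≈⟨ *-identityʳ y ⟨
    y * 1#        ≈⟨ *-congˡ xy′≈1 ⟨
    y * (x * y′)  ≈⟨ *-assoc y x y′ ⟨
    (y * x) * y′  ≈⟨ *-congʳ (trans (*-comm y x) xy≈1) ⟩
    1# * y′       ≈⟨ *-identityˡ y′ ⟩
    y′            ∎

  *-cancelˡ-nonzero : ∀ {a b d} → a ≉ 0# → a * b ≈ a * d → b ≈ d
  *-cancelˡ-nonzero {a} {b} {d} a≉0 ab≈ad =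
    let y , ay≈1 = *-inverse a≉0 in begin
    b            ≈⟨ *-identityˡ b ⟨
    1# * b       ≈⟨ *-congʳ (trans (*-comm y a) ay≈1) ⟨
    (y * a) * b  ≈⟨ *-assoc y a b ⟩
    y * (a * b)  ≈⟨ *-congˡ ab≈ad ⟩
    y * (a * d)  ≈⟨ *-assoc y a d ⟨
    (y * a) * d  ≈⟨ *-congʳ (trans (*-comm y a) ay≈1) ⟩
    1# * d       ≈⟨ *-identityˡ d ⟩
    d            ∎

  zero-product : ∀ {a b} → a * b ≈ 0# → a ≈ 0# ⊎ b ≈ 0#
  zero-product {a} {b} ab≈0 with a ≟ 0#
  ... | yes a≈0 = inj₁ a≈0
  ... | no  a≉0 = inj₂ (*-cancelˡ-nonzero a≉0 (trans ab≈0 (sym (zeroʳ a))))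

  *-nonzero : ∀ {a b} → a ≉ 0# → b ≉ 0# → a * b ≉ 0#
  *-nonzero a≉0 b≉0 ab≈0 with zero-product ab≈0
  ... | inj₁ a≈0 = a≉0 a≈0
  ... | inj₂ b≈0 = b≉0 b≈0

  ^-nonzero : ∀ {x} n → x ≉ 0# → x ^ n ≉ 0#
  ^-nonzero zero    _   = 1≉0
  ^-nonzero (suc n) x≉0 = *-nonzero x≉0 (^-nonzero n x≉0)

  -- Two of the N + 1 powers 1, x, …, x^N coincide.
  inverse-is-power : ∀ {x} → x ≉ 0# → ∃ λ r → x * x ^ r ≈ 1#
  inverse-is-power {x} x≉0 with Fin.pigeonhole (ℕ.n<1+n N) (λ (i : Fin (suc N)) → to (x ^ toℕ i))
  ... | i , j , i<j , eq with ℕ.m≤n⇒∃[o]m+o≡n (Fin.toℕ-mono-< i<j)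
  ... | r , i+1+r≡j = r , sym (*-cancelˡ-nonzero (^-nonzero (toℕ i) x≉0) (begin
    x ^ toℕ i * 1#                   ≈⟨ *-identityʳ _ ⟩
    x ^ toℕ i                        ≈⟨ to-injective eq ⟩
    x ^ toℕ j                        ≈⟨ ^-congʳ x (≡.trans (≡.sym i+1+r≡j) (≡.sym (ℕ.+-suc (toℕ i) r))) ⟩
    x ^ (toℕ i ℕ.+ suc r)            ≈⟨ ^-homo-* x (toℕ i) (suc r) ⟩
    x ^ toℕ i * (x * x ^ r)          ∎))

  -- The characteristic and the Frobenius map
  ι : ℕ → F
  ι n = n ⨰ 1#

  ι-homo-+ : ∀ m n → ι (m ℕ.+ n) ≈ ι m + ι n
  ι-homo-+ = ×-homo-+ 1#

  ι-homo-* : ∀ m n → ι (m ℕ.* n) ≈ ι m * ι n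
  ι-homo-* = ×1-homo-*

  ι1≈1 : ι 1 ≈ 1#
  ι1≈1 = ×-homo-1 1#

  ι-homo-^ : ∀ e r → ι (e ℕ.^ r) ≈ ι e ^ r
  ι-homo-^ e zero    = ι1≈1
  ι-homo-^ e (suc r) = trans (ι-homo-* e (e ℕ.^ r)) (*-congˡ (ι-homo-^ e r))

  n⨰x≈ι[n]*x : ∀ n x → n ⨰ x ≈ ι n * x
  n⨰x≈ι[n]*x n x = sym (trans (×-assoc-* n 1# x) (×-congʳ n (*-identityˡ x)))

  private
    -- Two of ι 0, …, ι N coincide.
    ι-vanishes : ∃ λ m → ι (suc m) ≈ 0#
    ι-vanishes with Fin.pigeonhole (ℕ.n<1+n N) (λ (i : Fin (suc N)) → to (ι (toℕ i)))
    ... | i , j , i<j , eq with ℕ.m≤n⇒∃[o]m+o≡n (Fin.toℕ-mono-< i<j)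
    ... | r , i+1+r≡j = r , sym (+-cancelˡ (ι (toℕ i)) _ _ (begin
      ι (toℕ i) + 0#              ≈⟨ +-identityʳ _ ⟩
      ι (toℕ i)                   ≈⟨ to-injective eq ⟩
      ι (toℕ j)                   ≡⟨ ≡.cong ι (≡.trans (≡.sym i+1+r≡j) (≡.sym (ℕ.+-suc (toℕ i) r))) ⟩
      ι (toℕ i ℕ.+ suc r)         ≈⟨ ι-homo-+ (toℕ i) (suc r) ⟩
      ι (toℕ i) + ι (suc r)       ∎))

    -- Opaque, so that unification never starts computing p by this search.
    opaque
      characteristic : ∃ λ m → ι (suc m) ≈ 0# × (∀ {d} → d ℕ.< m → ι (suc d) ≉ 0#)
      characteristic with ι-vanishes
      ... | m , ι[1+m]≈0 with Fin.¬∀⟶∃¬-smallest (suc m) (λ i → ι (suc (toℕ i)) ≉ 0#)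
                                (λ i → ¬? (ι (suc (toℕ i)) ≟ 0#))
                                (λ all → all (Fin.fromℕ m) (≡.subst (λ n → ι (suc n) ≈ 0#) (≡.sym (Fin.toℕ-fromℕ m)) ι[1+m]≈0))
      ... | i , ¬ι[1+i]≉0 , below = toℕ i , decidable-stable (_ ≟ 0#) ¬ι[1+i]≉0 , λ {d} d<i →
        ≡.subst (λ n → ι (suc n) ≉ 0#) (≡.trans (Fin.toℕ-inject (Fin.fromℕ< d<i)) (Fin.toℕ-fromℕ< d<i))
                (below (Fin.fromℕ< d<i))

  p : ℕ
  p = suc (proj₁ characteristic)

  ι[p]≈0 : ι p ≈ 0#
  ι[p]≈0 = proj₁ (proj₂ characteristic)

  ι≉0-below-p : ∀ {d} → 0 ℕ.< d → d ℕ.< p → ι d ≉ 0#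
  ι≉0-below-p {suc d} _ (s≤s d<p-1) = proj₂ (proj₂ characteristic) d<p-1

  ι[d]≈0⇒p≤d : ∀ {d} → 0 ℕ.< d → ι d ≈ 0# → p ℕ.≤ d
  ι[d]≈0⇒p≤d {d} 0<d ι[d]≈0 with p ℕ.≤? d
  ... | yes p≤d = p≤d
  ... | no  p≰d = ⊥-elim (ι≉0-below-p 0<d (ℕ.≰⇒> p≰d) ι[d]≈0)

  2≤p : 2 ℕ.≤ p
  2≤p = s≤s (ℕ.n≢0⇒n>0 λ p-1≡0 →
    1≉0 (trans (sym ι1≈1) (≡.subst (λ n → ι (suc n) ≈ 0#) p-1≡0 ι[p]≈0)))

  p-irreducible : Irreducible p
  p-irreducible {d} d∣p@(divides e p≡e*d) with zero-product (trans (sym (ι-homo-* e d)) (≡.subst (λ n → ι n ≈ 0#) p≡e*d ι[p]≈0))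
  ... | inj₂ ι[d]≈0 = inj₂ (ℕ.≤-antisym (∣⇒≤ d∣p) (ι[d]≈0⇒p≤d (ℕ.n≢0⇒n>0 d≢0) ι[d]≈0))
    where
    d≢0 : d ≢ 0
    d≢0 ≡.refl = ℕ.1+n≢0 (≡.trans p≡e*d (ℕ.*-zeroʳ e))
  ... | inj₁ ι[e]≈0 = inj₁ (ℕ.*-cancelˡ-≡ d 1 p (≡.sym (≡.trans (ℕ.*-identityʳ p) (≡.trans p≡e*d (≡.cong (ℕ._* d) e≡p)))))
    where
    e∣p : e ∣ p
    e∣p = divides d (≡.trans p≡e*d (ℕ.*-comm e d))
    e≢0 : e ≢ 0
    e≢0 ≡.refl = ℕ.1+n≢0 p≡e*d
    e≡p : e ≡ p
    e≡p = ℕ.≤-antisym (∣⇒≤ e∣p) (ι[d]≈0⇒p≤d (ℕ.n≢0⇒n>0 e≢0) ι[e]≈0)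

  ι[m!]≉0 : ∀ {m} → m ℕ.< p → ι (m !) ≉ 0#
  ι[m!]≉0 {zero}  _     ι[1]≈0 = 1≉0 (trans (sym ι1≈1) ι[1]≈0)
  ι[m!]≉0 {suc m} 1+m<p ι≈0    =
    *-nonzero (ι≉0-below-p (s≤s z≤n) 1+m<p) (ι[m!]≉0 (ℕ.<-trans (ℕ.n<1+n m) 1+m<p))
              (trans (sym (ι-homo-* (suc m) (m !))) ι≈0)

  ι[pCk]≈0 : ∀ {k} → 0 ℕ.< k → k ℕ.< p → ι (p C k) ≈ 0#
  ι[pCk]≈0 {k} 0<k k<p with zero-product (begin
    ι (p C k) * ι (k ! ℕ.* (p ℕ.∸ k) !)   ≈⟨ ι-homo-* (p C k) _ ⟨
    ι ((p C k) ℕ.* (k ! ℕ.* (p ℕ.∸ k) !)) ≡⟨ ≡.cong ι pCk*k!*[p-k]!≡p! ⟩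
    ι (p !)                               ≈⟨ ι-homo-* p ((p ℕ.∸ 1) !) ⟩
    ι p * ι ((p ℕ.∸ 1) !)                 ≈⟨ *-congʳ ι[p]≈0 ⟩
    0# * ι ((p ℕ.∸ 1) !)                  ≈⟨ zeroˡ _ ⟩
    0#                                    ∎)
    where
    pCk*k!*[p-k]!≡p! : (p C k) ℕ.* (k ! ℕ.* (p ℕ.∸ k) !) ≡ p !
    pCk*k!*[p-k]!≡p! = ≡.trans (≡.cong (ℕ._* (k ! ℕ.* (p ℕ.∸ k) !)) (nCk≡n!/k![n-k]! (ℕ.<⇒≤ k<p)))
                               (m/n*n≡m {{ℕ._!*_!≢0 k (p ℕ.∸ k)}} (k![n∸k]!∣n! (ℕ.<⇒≤ k<p)))
  ... | inj₁ ι[pCk]≈0 = ι[pCk]≈0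
  ... | inj₂ ι≈0 = ⊥-elim (*-nonzero (ι[m!]≉0 k<p) (ι[m!]≉0 (ℕ.∸-monoʳ-< 0<k (ℕ.<⇒≤ k<p)))
                                     (trans (sym (ι-homo-* (k !) _)) ι≈0))

  sum≈last : ∀ m (g : Fin (suc m) → F) → (∀ i → toℕ i ℕ.< m → g i ≈ 0#) → sum g ≈ g (Fin.fromℕ m)
  sum≈last zero    g _      = +-identityʳ (g Fin.zero)
  sum≈last (suc m) g g≈0 = begin
    g Fin.zero + sum (g ∘ Fin.suc)  ≈⟨ +-congʳ (g≈0 Fin.zero (s≤s z≤n)) ⟩
    0# + sum (g ∘ Fin.suc)          ≈⟨ +-identityˡ _ ⟩
    sum (g ∘ Fin.suc)               ≈⟨ sum≈last m (g ∘ Fin.suc) (λ i i<m → g≈0 (Fin.suc i) (s≤s i<m)) ⟩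
    g (Fin.suc (Fin.fromℕ m))       ∎

  frobenius : ∀ x y → (x + y) ^ p ≈ x ^ p + y ^ p
  frobenius x y = begin
    (x + y) ^ p                                  ≈⟨ Binomial.theorem p x y ⟩
    term Fin.zero + sum (term ∘ Fin.suc)         ≈⟨ +-cong first-term (sum≈last _ _ middle-term) ⟩
    y ^ p + term (Fin.suc (Fin.fromℕ (p ℕ.∸ 1))) ≈⟨ +-congˡ last-term ⟩
    y ^ p + x ^ p                                ≈⟨ +-comm _ _ ⟩
    x ^ p + y ^ p                                ∎
    where
    term : Fin (suc p) → F
    term = Binomial.binomialTerm x y p
    first-term : term Fin.zero ≈ y ^ p
    first-term = trans (×-homo-1 _) (*-identityˡ _)
    middle-term : ∀ i → toℕ i ℕ.< p ℕ.∸ 1 → term (Fin.suc i) ≈ 0#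
    middle-term i i<p-1 = begin
      term (Fin.suc i)                                      ≈⟨ n⨰x≈ι[n]*x (p C suc (toℕ i)) _ ⟩
      ι (p C suc (toℕ i)) * Binomial.binomial x y p (Fin.suc i) ≈⟨ *-congʳ (ι[pCk]≈0 (s≤s z≤n) (s≤s i<p-1)) ⟩
      0# * Binomial.binomial x y p (Fin.suc i)               ≈⟨ zeroˡ _ ⟩
      0#                                                    ∎
    last-term : term (Fin.suc (Fin.fromℕ (p ℕ.∸ 1))) ≈ x ^ p
    last-term rewrite Fin.toℕ-fromℕ (p ℕ.∸ 1) | nCn≡1 p | ℕ.n∸n≡0 p =
      trans (×-homo-1 _) (*-identityʳ _)

  frobenius-^ : ∀ e x y → (x + y) ^ (p ℕ.^ e) ≈ x ^ (p ℕ.^ e) + y ^ (p ℕ.^ e)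
  frobenius-^ zero    x y = trans (*-identityʳ _) (sym (+-cong (*-identityʳ x) (*-identityʳ y)))
  frobenius-^ (suc e) x y = begin
    (x + y) ^ (p ℕ.* p ℕ.^ e)                 ≈⟨ ^-assocʳ (x + y) p (p ℕ.^ e) ⟨
    ((x + y) ^ p) ^ (p ℕ.^ e)                 ≈⟨ ^-congˡ (p ℕ.^ e) (frobenius x y) ⟩
    (x ^ p + y ^ p) ^ (p ℕ.^ e)               ≈⟨ frobenius-^ e (x ^ p) (y ^ p) ⟩
    (x ^ p) ^ (p ℕ.^ e) + (y ^ p) ^ (p ℕ.^ e) ≈⟨ +-cong (^-assocʳ x p (p ℕ.^ e)) (^-assocʳ y p (p ℕ.^ e)) ⟩
    x ^ (p ℕ.* p ℕ.^ e) + y ^ (p ℕ.* p ℕ.^ e) ∎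

  ι[m%p]≈ι[m] : ∀ m → ι (m % p) ≈ ι m
  ι[m%p]≈ι[m] m = sym (begin
    ι m                                 ≡⟨ ≡.cong ι (m≡m%n+[m/n]*n m p) ⟩
    ι (m % p ℕ.+ (m / p) ℕ.* p)         ≈⟨ ι-homo-+ (m % p) _ ⟩
    ι (m % p) + ι ((m / p) ℕ.* p)       ≈⟨ +-congˡ (ι-homo-* (m / p) p) ⟩
    ι (m % p) + ι (m / p) * ι p         ≈⟨ +-congˡ (trans (*-congˡ ι[p]≈0) (zeroʳ _)) ⟩
    ι (m % p) + 0#                      ≈⟨ +-identityʳ _ ⟩
    ι (m % p)                           ∎)

  ι[p∸1]*x≈-x : ∀ x → ι (p ℕ.∸ 1) * x ≈ - x
  ι[p∸1]*x≈-x x = +-cancelˡ x _ _ (begin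
    x + ι (p ℕ.∸ 1) * x        ≈⟨ +-congʳ (*-identityˡ x) ⟨
    1# * x + ι (p ℕ.∸ 1) * x   ≈⟨ +-congʳ (*-congʳ ι1≈1) ⟨
    ι 1 * x + ι (p ℕ.∸ 1) * x  ≈⟨ distribʳ x (ι 1) _ ⟨
    (ι 1 + ι (p ℕ.∸ 1)) * x    ≈⟨ *-congʳ (ι-homo-+ 1 (p ℕ.∸ 1)) ⟨
    ι p * x                    ≈⟨ *-congʳ ι[p]≈0 ⟩
    0# * x                     ≈⟨ zeroˡ x ⟩
    0#                         ≈⟨ -‿inverseʳ x ⟨
    x + - x                    ∎)

  -- F as a vector space over 𝔽ₚ
  residue : ℕ → Fin p
  residue m = Fin.fromℕ< (m%n<n m p)

  ι[residue]≈ι : ∀ m → ι (toℕ (residue m)) ≈ ι m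
  ι[residue]≈ι m = trans (reflexive (≡.cong ι (Fin.toℕ-fromℕ< (m%n<n m p)))) (ι[m%p]≈ι[m] m)

  -- Index i ↦ the 𝔽ₚ-combination of zs whose coefficients are the base-p digits of i.
  combination : (zs : List F) → Fin (p ℕ.^ length zs) → F
  combination []       _ = 0#
  combination (z ∷ zs) i =
    ι (toℕ (Fin.quotient {p} (p ℕ.^ length zs) i)) * z + combination zs (Fin.remainder {p} (p ℕ.^ length zs) i)

  combination-combine : ∀ z zs c r →
    combination (z ∷ zs) (Fin.combine c r) ≈ ι (toℕ c) * z + combination zs r
  combination-combine z zs c r = reflexive
    (≡.cong (λ (c , r) → ι (toℕ c) * z + combination zs r) (Fin.remQuot-combine {p} {p ℕ.^ length zs} c r))

  record Spanned (zs : List F) (w : F) : Set ℓ where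
    constructor _,_
    field
      index    : Fin (p ℕ.^ length zs)
      index-eq : combination zs index ≈ w

  spanned-resp : ∀ {zs v w} → v ≈ w → Spanned zs v → Spanned zs w
  spanned-resp v≈w (i , eq) = i , trans eq v≈w

  spanned-+ : ∀ zs {v w} → Spanned zs v → Spanned zs w → Spanned zs (v + w)
  spanned-+ []       (_ , 0≈v) (_ , 0≈w) = Fin.zero , trans (sym (+-identityʳ 0#)) (+-cong 0≈v 0≈w)
  spanned-+ (z ∷ zs) {v} {w} (i , eqv) (j , eqw) = Fin.combine (residue (toℕ cᵢ ℕ.+ toℕ cⱼ)) u , (begin
    combination (z ∷ zs) (Fin.combine (residue (toℕ cᵢ ℕ.+ toℕ cⱼ)) u)
      ≈⟨ combination-combine z zs (residue (toℕ cᵢ ℕ.+ toℕ cⱼ)) u ⟩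
    ι (toℕ (residue (toℕ cᵢ ℕ.+ toℕ cⱼ))) * z + combination zs u
      ≈⟨ +-cong (*-congʳ (trans (ι[residue]≈ι (toℕ cᵢ ℕ.+ toℕ cⱼ)) (ι-homo-+ (toℕ cᵢ) (toℕ cⱼ))))
                (Spanned.index-eq tails) ⟩
    (ι (toℕ cᵢ) + ι (toℕ cⱼ)) * z + (combination zs rᵢ + combination zs rⱼ)
      ≈⟨ +-congʳ (distribʳ z _ _) ⟩
    (ι (toℕ cᵢ) * z + ι (toℕ cⱼ) * z) + (combination zs rᵢ + combination zs rⱼ)
      ≈⟨ +-interchange _ _ _ _ ⟩
    (ι (toℕ cᵢ) * z + combination zs rᵢ) + (ι (toℕ cⱼ) * z + combination zs rⱼ)
      ≈⟨ +-cong eqv eqw ⟩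
    v + w ∎)
    where
    cᵢ = Fin.quotient {p} (p ℕ.^ length zs) i
    cⱼ = Fin.quotient {p} (p ℕ.^ length zs) j
    rᵢ = Fin.remainder {p} (p ℕ.^ length zs) i
    rⱼ = Fin.remainder {p} (p ℕ.^ length zs) j
    tails : Spanned zs (combination zs rᵢ + combination zs rⱼ)
    tails = spanned-+ zs (rᵢ , refl) (rⱼ , refl)
    u = Spanned.index tails

  spanned-ι* : ∀ zs n {w} → Spanned zs w → Spanned zs (ι n * w)
  spanned-ι* []       n (_ , 0≈w) = Fin.zero , trans (sym (zeroʳ (ι n))) (*-congˡ 0≈w)
  spanned-ι* (z ∷ zs) n {w} (i , eqw) = Fin.combine (residue (n ℕ.* toℕ cᵢ)) u , (begin
    combination (z ∷ zs) (Fin.combine (residue (n ℕ.* toℕ cᵢ)) u)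
      ≈⟨ combination-combine z zs (residue (n ℕ.* toℕ cᵢ)) u ⟩
    ι (toℕ (residue (n ℕ.* toℕ cᵢ))) * z + combination zs u
      ≈⟨ +-cong (*-congʳ (trans (ι[residue]≈ι (n ℕ.* toℕ cᵢ)) (ι-homo-* n (toℕ cᵢ)))) (Spanned.index-eq tail) ⟩
    (ι n * ι (toℕ cᵢ)) * z + ι n * combination zs rᵢ
      ≈⟨ +-congʳ (*-assoc _ _ _) ⟩
    ι n * (ι (toℕ cᵢ) * z) + ι n * combination zs rᵢ
      ≈⟨ distribˡ _ _ _ ⟨
    ι n * (ι (toℕ cᵢ) * z + combination zs rᵢ)
      ≈⟨ *-congˡ eqw ⟩
    ι n * w ∎)
    where
    cᵢ = Fin.quotient {p} (p ℕ.^ length zs) i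
    rᵢ = Fin.remainder {p} (p ℕ.^ length zs) i
    tail : Spanned zs (ι n * combination zs rᵢ)
    tail = spanned-ι* zs n (rᵢ , refl)
    u = Spanned.index tail

  spanned-− : ∀ zs {v w} → Spanned zs v → Spanned zs w → Spanned zs (v - w)
  spanned-− zs sv sw = spanned-+ zs sv (spanned-resp (ι[p∸1]*x≈-x _) (spanned-ι* zs (p ℕ.∸ 1) sw))

  spanned-ι*⇒spanned : ∀ zs {e z} → 0 ℕ.< e → e ℕ.< p → Spanned zs (ι e * z) → Spanned zs z
  spanned-ι*⇒spanned zs {e} {z} 0<e e<p s with inverse-is-power (ι≉0-below-p 0<e e<p)
  ... | r , ι[e]*ι[e]^r≈1 = spanned-resp (begin
    ι (e ℕ.^ r) * (ι e * z)   ≈⟨ *-congʳ (ι-homo-^ e r) ⟩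
    ι e ^ r * (ι e * z)       ≈⟨ *-assoc _ _ _ ⟨
    (ι e ^ r * ι e) * z       ≈⟨ *-congʳ (trans (*-comm _ _) ι[e]*ι[e]^r≈1) ⟩
    1# * z                    ≈⟨ *-identityˡ z ⟩
    z                         ∎) (spanned-ι* zs (e ℕ.^ r) s)

  Independent : List F → Set ℓ
  Independent []       = ⊤
  Independent (z ∷ zs) = ¬ Spanned zs z × Independent zs

  x≈y+z⇒y≈x-z : ∀ {x y z} → x ≈ y + z → y ≈ x - z
  x≈y+z⇒y≈x-z {x} {y} {z} x≈y+z = begin
    y             ≈⟨ +-identityʳ y ⟨
    y + 0#        ≈⟨ +-congˡ (-‿inverseʳ z) ⟨
    y + (z - z)   ≈⟨ +-assoc y z (- z) ⟨
    (y + z) - z   ≈⟨ +-congʳ x≈y+z ⟨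
    x - z         ∎

  smaller-coefficient-impossible : ∀ zs {z a b v w} → ¬ Spanned zs z → a ℕ.< b → b ℕ.< p →
    Spanned zs v → Spanned zs w → ι a * z + v ≈ ι b * z + w → ⊥
  smaller-coefficient-impossible zs {z} {a} {b} {v} {w} z∉ a<b b<p sv sw eq
    with ℕ.m≤n⇒∃[o]m+o≡n a<b
  ... | e , a+1+e≡b = z∉ (spanned-ι*⇒spanned zs (s≤s z≤n) 1+e<p
                         (spanned-resp (sym (x≈y+z⇒y≈x-z v≈ι[1+e]*z+w)) (spanned-− zs sv sw)))
    where
    b≡a+[1+e] : b ≡ a ℕ.+ suc e
    b≡a+[1+e] = ≡.trans (≡.sym a+1+e≡b) (≡.sym (ℕ.+-suc a e))
    1+e<p : suc e ℕ.< p
    1+e<p = ℕ.≤-<-trans (ℕ.m≤n+m (suc e) a) (≡.subst (ℕ._< p) b≡a+[1+e] b<p)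
    v≈ι[1+e]*z+w : v ≈ ι (suc e) * z + w
    v≈ι[1+e]*z+w = +-cancelˡ (ι a * z) _ _ (begin
      ι a * z + v                       ≈⟨ eq ⟩
      ι b * z + w                       ≡⟨ ≡.cong (λ n → ι n * z + w) b≡a+[1+e] ⟩
      ι (a ℕ.+ suc e) * z + w           ≈⟨ +-congʳ (*-congʳ (ι-homo-+ a (suc e))) ⟩
      (ι a + ι (suc e)) * z + w         ≈⟨ +-congʳ (distribʳ z (ι a) _) ⟩
      (ι a * z + ι (suc e) * z) + w     ≈⟨ +-assoc _ _ w ⟩
      ι a * z + (ι (suc e) * z + w)     ∎)

  coefficient-unique : ∀ zs {z a b v w} → ¬ Spanned zs z → a ℕ.< p → b ℕ.< p →
    Spanned zs v → Spanned zs w → ι a * z + v ≈ ι b * z + w → a ≡ b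
  coefficient-unique zs {a = a} {b} z∉ a<p b<p sv sw eq with ℕ.<-cmp a b
  ... | tri< a<b _ _ = ⊥-elim (smaller-coefficient-impossible zs z∉ a<b b<p sv sw eq)
  ... | tri≈ _ a≡b _ = a≡b
  ... | tri> _ _ b<a = ⊥-elim (smaller-coefficient-impossible zs z∉ b<a a<p sw sv (sym eq))

  combination-injective : ∀ zs → Independent zs → Injective _≡_ _≈_ (combination zs)
  combination-injective []       _          {Fin.zero} {Fin.zero} _  = ≡.refl
  combination-injective (z ∷ zs) (z∉ , ind) {i}        {j}        eq =
    ≡.trans (≡.sym (Fin.combine-remQuot {p} (p ℕ.^ length zs) i))
            (≡.trans (≡.cong₂ Fin.combine cᵢ≡cⱼ rᵢ≡rⱼ) (Fin.combine-remQuot {p} (p ℕ.^ length zs) j))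
    where
    cᵢ = Fin.quotient {p} (p ℕ.^ length zs) i
    cⱼ = Fin.quotient {p} (p ℕ.^ length zs) j
    rᵢ = Fin.remainder {p} (p ℕ.^ length zs) i
    rⱼ = Fin.remainder {p} (p ℕ.^ length zs) j
    cᵢ≡cⱼ : cᵢ ≡ cⱼ
    cᵢ≡cⱼ = Fin.toℕ-injective
      (coefficient-unique zs z∉ (Fin.toℕ<n cᵢ) (Fin.toℕ<n cⱼ) (rᵢ , refl) (rⱼ , refl) eq)
    rᵢ≡rⱼ : rᵢ ≡ rⱼ
    rᵢ≡rⱼ = combination-injective zs ind
      (+-cancelˡ _ _ _ (trans eq (+-congʳ (*-congʳ (reflexive (≡.cong (ι ∘ toℕ) (≡.sym cᵢ≡cⱼ)))))))

  spanned? : ∀ zs → Decidable (Spanned zs)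
  spanned? zs w = map′ (λ (i , eq) → i , eq) (λ (i , eq) → i , eq) (Fin.any? (λ i → combination zs i ≟ w))

  n<p^n : ∀ n → n ℕ.< p ℕ.^ n
  n<p^n zero    = s≤s z≤n
  n<p^n (suc n) = ℕ.≤-<-trans (n<p^n n)
    (≡.subst (p ℕ.^ n ℕ.<_) (ℕ.*-comm (p ℕ.^ n) p) (ℕ.m<m*n (p ℕ.^ n) p {{ℕ.m^n≢0 p n}} 2≤p))

  private
    -- Grow an independent list by elements outside its span until it spans F; the fuel
    -- N ∸ length zs never runs out, since length zs < p ^ length zs ≤ N.
    extend-to-basis : ∀ fuel zs → Independent zs → length zs ℕ.+ fuel ≡ N → ∃ λ a → N ≡ p ℕ.^ a
    extend-to-basis fuel zs ind _ with Fin.all? (spanned? zs ∘ from)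
    ... | yes spanning = length zs ,
      ℕ.≤-antisym (surjective⇒N≤ (combination zs) onto) (injective⇒≤N (combination-injective zs ind))
      where
      onto : ∀ w → ∃ λ i → combination zs i ≈ w
      onto w with spanned-resp (inverseʳ ≡.refl) (spanning (to w))
      ... | i , eq = i , eq
    extend-to-basis zero zs ind len≡N | no _ = ⊥-elim (ℕ.<⇒≱ (n<p^n (length zs))
      (≡.subst (p ℕ.^ length zs ℕ.≤_) (≡.trans (≡.sym len≡N) (ℕ.+-identityʳ _))
               (injective⇒≤N (combination-injective zs ind))))
    extend-to-basis (suc fuel) zs ind len≡N | no ¬spanning with Fin.¬∀⟶∃¬ N _ (spanned? zs ∘ from) ¬spanning
    ... | n , n∉ = extend-to-basis fuel (from n ∷ zs) (n∉ , ind) (≡.trans (≡.sym (ℕ.+-suc (length zs) fuel)) len≡N)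

  N≡p^a : ∃ λ a → N ≡ p ℕ.^ a
  N≡p^a = extend-to-basis N [] _ ≡.refl

  2≤N : 2 ℕ.≤ N
  2≤N = injective⇒≤N {f = 0-or-1} 0-or-1-injective
    where
    0-or-1 : Fin 2 → F
    0-or-1 Fin.zero           = 0#
    0-or-1 (Fin.suc Fin.zero) = 1#
    0-or-1-injective : Injective _≡_ _≈_ 0-or-1
    0-or-1-injective {Fin.zero}         {Fin.zero}         _   = ≡.refl
    0-or-1-injective {Fin.zero}         {Fin.suc Fin.zero} 0≈1 = ⊥-elim (1≉0 (sym 0≈1))
    0-or-1-injective {Fin.suc Fin.zero} {Fin.zero}         1≈0 = ⊥-elim (1≉0 1≈0)
    0-or-1-injective {Fin.suc Fin.zero} {Fin.suc Fin.zero} _   = ≡.refl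

  Q^t≡N⇒Q≡p^E : ∀ {Q t} → 0 ℕ.< t → Q ℕ.^ t ≡ N → ∃ λ E → Q ≡ p ℕ.^ E
  Q^t≡N⇒Q≡p^E {Q} {suc t} _ Q^t≡N with N≡p^a
  ... | a , N≡p^a = ∣p^a⇒≡p^e p-irreducible a (≡.subst (Q ∣_) (≡.trans Q^t≡N N≡p^a) (m∣m*n (Q ℕ.^ t)))

  Q^t≡N⇒2≤Q : ∀ {Q t} → 0 ℕ.< t → Q ℕ.^ t ≡ N → 2 ℕ.≤ Q
  Q^t≡N⇒2≤Q {0}           {suc t} _ 0≡N   = ⊥-elim (ℕ.<⇒≱ 2≤N (ℕ.≤-trans (ℕ.≤-reflexive (≡.sym 0≡N)) z≤n))
  Q^t≡N⇒2≤Q {1}           {t}     _ 1^t≡N = ⊥-elim (ℕ.<⇒≱ 2≤N (ℕ.≤-reflexive (≡.trans (≡.sym 1^t≡N) (ℕ.^-zeroˡ t))))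
  Q^t≡N⇒2≤Q {suc (suc Q)} {t}     _ _     = s≤s (s≤s z≤n)

  -- FF.IsSubfield fixes the level of the predicate to c ⊔ ℓ, while 𝔽_{q^k} is a predicate of level ℓ.
  record IsSubfieldˡ (K : Pred F ℓ) : Set (c ⊔ ℓ) where
    field
      resp      : ∀ {x y} → x ≈ y → K x → K y
      has0      : K 0#
      has1      : K 1#
      closed+   : ∀ {x y} → K x → K y → K (x + y)
      closed-   : ∀ {x} → K x → K (- x)
      closed*   : ∀ {x y} → K x → K y → K (x * y)
      closedInv : ∀ {x y} → K x → x * y ≈ 1# → K y

  module Listing {K : Pred F ℓ} (K-resp : ∀ {x y} → x ≈ y → K x → K y) (K? : Decidable K) where
    private module E = Enumeration (enumerate (K? ∘ from))
    open E public using (size)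

    element : Fin size → F
    element = from ∘ E.index

    element-injective : Injective _≡_ _≈_ element
    element-injective = E.injective ∘ from-injective

    element-sound : ∀ i → K (element i)
    element-sound = E.sound

    element-complete : ∀ {x} → K x → ∃ λ i → element i ≈ x
    element-complete {x} Kx with E.complete (to x) (K-resp (sym (inverseʳ ≡.refl)) Kx)
    ... | i , index≡to[x] = i , trans (reflexive (≡.cong from index≡to[x])) (inverseʳ ≡.refl)

  1^n≈1 : ∀ n → 1# ^ n ≈ 1#
  1^n≈1 zero    = refl
  1^n≈1 (suc n) = trans (*-identityˡ _) (1^n≈1 n)

  module FixedField (Q : ℕ) {E} (Q≡p^E : Q ≡ p ℕ.^ E) where
    Fixed : Pred F ℓ
    Fixed x = x ^ Q ≈ x

    frobenius-Q : ∀ x y → (x + y) ^ Q ≈ x ^ Q + y ^ Q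
    frobenius-Q x y rewrite Q≡p^E = frobenius-^ E x y

    fixed-resp : ∀ {x y} → x ≈ y → Fixed x → Fixed y
    fixed-resp x≈y x^Q≈x = trans (^-congˡ Q (sym x≈y)) (trans x^Q≈x x≈y)

    fixed-0 : Fixed 0#
    fixed-0 = trans (^-congʳ 0# Q≡1+[Q∸1]) (zeroˡ _)
      where
      instance _ = ℕ.m^n≢0 p E
      Q≡1+[Q∸1] : Q ≡ suc (ℕ.pred Q)
      Q≡1+[Q∸1] rewrite Q≡p^E = ≡.sym (ℕ.suc-pred (p ℕ.^ E))

    fixed-+ : ∀ {x y} → Fixed x → Fixed y → Fixed (x + y)
    fixed-+ x^Q≈x y^Q≈y = trans (frobenius-Q _ _) (+-cong x^Q≈x y^Q≈y)

    fixed-* : ∀ {x y} → Fixed x → Fixed y → Fixed (x * y)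
    fixed-* x^Q≈x y^Q≈y = trans (^-distrib-* _ _ Q) (*-cong x^Q≈x y^Q≈y)

    fixed-neg : ∀ {x} → Fixed x → Fixed (- x)
    fixed-neg {x} x^Q≈x = sym (+-cancelˡ x _ _ (begin
      x - x              ≈⟨ -‿inverseʳ x ⟩
      0#                 ≈⟨ fixed-0 ⟨
      0# ^ Q             ≈⟨ ^-congˡ Q (-‿inverseʳ x) ⟨
      (x - x) ^ Q        ≈⟨ frobenius-Q x (- x) ⟩
      x ^ Q + (- x) ^ Q  ≈⟨ +-congʳ x^Q≈x ⟩
      x + (- x) ^ Q      ∎))

    fixed-inv : ∀ {x y} → Fixed x → x * y ≈ 1# → Fixed y
    fixed-inv {x} {y} x^Q≈x xy≈1 = inverse-unique (begin
      x * y ^ Q      ≈⟨ *-congʳ x^Q≈x ⟨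
      x ^ Q * y ^ Q  ≈⟨ ^-distrib-* x y Q ⟨
      (x * y) ^ Q    ≈⟨ ^-congˡ Q xy≈1 ⟩
      1# ^ Q         ≈⟨ 1^n≈1 Q ⟩
      1#             ∎) xy≈1

    fixed-subfield : IsSubfieldˡ Fixed
    fixed-subfield = record
      { resp = fixed-resp ; has0 = fixed-0 ; has1 = 1^n≈1 Q ; closed+ = fixed-+
      ; closed- = fixed-neg ; closed* = fixed-* ; closedInv = fixed-inv }

    fixed? : Decidable Fixed
    fixed? x = x ^ Q ≟ x

    module FixedElements = Listing fixed-resp fixed?

    -- The fixed elements are roots of X^Q − X = X^Q + 0·X^(Q−1) + ⋯ + 0·X² − X + 0.
    fixed-count≤Q : 2 ℕ.≤ Q → FixedElements.size ℕ.≤ Q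
    fixed-count≤Q 2≤Q = ≡.subst (FixedElements.size ℕ.≤_) (≡.trans (≡.cong (2 ℕ.+_) (length-replicate (Q ℕ.∸ 2))) 2+[Q∸2]≡Q)
      (roots≤degree 1≉0 zero-product X^Q-X element element-injective (λ i → root (element-sound i)))
      where
      open FixedElements
      open MonicPolynomial R using (eval; roots≤degree)
      X^Q-X : List F
      X^Q-X = 0# ∷ - 1# ∷ replicate (Q ℕ.∸ 2) 0#
      2+[Q∸2]≡Q : 2 ℕ.+ (Q ℕ.∸ 2) ≡ Q
      2+[Q∸2]≡Q = ℕ.m+[n∸m]≡n 2≤Q
      eval-zeros : ∀ n x → eval (replicate n 0#) x ≈ x ^ n
      eval-zeros zero    x = refl
      eval-zeros (suc n) x = trans (+-identityˡ _) (*-congˡ (eval-zeros n x))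
      root : ∀ {x} → Fixed x → eval X^Q-X x ≈ 0#
      root {x} x^Q≈x = begin
        0# + x * (- 1# + x * eval (replicate (Q ℕ.∸ 2) 0#) x) ≈⟨ +-identityˡ _ ⟩
        x * (- 1# + x * eval (replicate (Q ℕ.∸ 2) 0#) x)      ≈⟨ *-congˡ (+-congˡ (*-congˡ (eval-zeros (Q ℕ.∸ 2) x))) ⟩
        x * (- 1# + x * x ^ (Q ℕ.∸ 2))                        ≈⟨ distribˡ x _ _ ⟩
        x * - 1# + x * (x * x ^ (Q ℕ.∸ 2))                    ≈⟨ +-cong (trans (*-comm x _) (-1*x≈-x x)) (^-congʳ x 2+[Q∸2]≡Q) ⟩
        - x + x ^ Q                                           ≈⟨ +-congˡ x^Q≈x ⟩
        - x + x                                               ≈⟨ -‿inverseˡ x ⟩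
        0#                                                    ∎

  module OverSubfield {K : Pred F ℓ} (K-subfield : IsSubfieldˡ K) (γ : F) where
    open IsSubfieldˡ K-subfield

    -- Span s = K + γK + ⋯ + γ^s K, with elements written in Horner form a₀ + γ (a₁ + γ (⋯)).
    data Span : ℕ → Pred F (c ⊔ ℓ) where
      const : ∀ {a z} → K a → z ≈ a → Span 0 z
      cons  : ∀ {s a v z} → K a → Span s v → z ≈ a + γ * v → Span (suc s) z

    span-resp : ∀ {s y z} → y ≈ z → Span s y → Span s z
    span-resp y≈z (const Ka y≈a)    = const Ka (trans (sym y≈z) y≈a)
    span-resp y≈z (cons Ka Sv y≈av) = cons Ka Sv (trans (sym y≈z) y≈av)

    a≈a+γ*0 : ∀ a → a ≈ a + γ * 0#
    a≈a+γ*0 a = sym (trans (+-congˡ (zeroʳ γ)) (+-identityʳ a))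

    K⊆span : ∀ s {a} → K a → Span s a
    K⊆span zero    Ka = const Ka refl
    K⊆span (suc s) Ka = cons Ka (K⊆span s has0) (a≈a+γ*0 _)

    span-+ : ∀ {s y z} → Span s y → Span s z → Span s (y + z)
    span-+ (const Ka y≈a) (const Kb z≈b) = const (closed+ Ka Kb) (+-cong y≈a z≈b)
    span-+ {y = y} {z} (cons {a = a} {v} Ka Sv y≈a+γv) (cons {a = b} {w} Kb Sw z≈b+γw) =
      cons (closed+ Ka Kb) (span-+ Sv Sw) (begin
        y + z                     ≈⟨ +-cong y≈a+γv z≈b+γw ⟩
        (a + γ * v) + (b + γ * w) ≈⟨ +-interchange _ _ _ _ ⟩
        (a + b) + (γ * v + γ * w) ≈⟨ +-congˡ (distribˡ γ v w) ⟨
        (a + b) + γ * (v + w)     ∎)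

    span-scale : ∀ {s b z} → K b → Span s z → Span s (b * z)
    span-scale Kb (const Ka z≈a) = const (closed* Kb Ka) (*-congˡ z≈a)
    span-scale {b = b} {z} Kb (cons {a = a} {v} Ka Sv z≈a+γv) = cons (closed* Kb Ka) (span-scale Kb Sv) (begin
      b * z              ≈⟨ *-congˡ z≈a+γv ⟩
      b * (a + γ * v)    ≈⟨ distribˡ b a (γ * v) ⟩
      b * a + b * (γ * v) ≈⟨ +-congˡ (x∙yz≈y∙xz b γ v) ⟩
      b * a + γ * (b * v) ∎)

    span-− : ∀ {s y z} → Span s y → Span s z → Span s (y - z)
    span-− Sy Sz = span-+ Sy (span-resp (-1*x≈-x _) (span-scale (closed- has1) Sz))

    span-suc : ∀ {s z} → Span s z → Span (suc s) z
    span-suc (const Ka z≈a)    = cons Ka (K⊆span 0 has0) (trans z≈a (a≈a+γ*0 _))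
    span-suc (cons Ka Sv z≈av) = cons Ka (span-suc Sv) z≈av

    span-mono : ∀ {s s′ z} → s ℕ.≤ s′ → Span s z → Span s′ z
    span-mono {s} {s′} {z} s≤s′ Sz = ≡.subst (λ n → Span n z) (ℕ.m∸n+n≡m s≤s′) (lift (s′ ℕ.∸ s))
      where
      lift : ∀ n → Span (n ℕ.+ s) z
      lift zero    = Sz
      lift (suc n) = span-suc (lift n)

    span-γ* : ∀ {s z} → Span s z → Span (suc s) (γ * z)
    span-γ* Sz = cons has0 Sz (sym (+-identityˡ _))

    span-γ^* : ∀ n {s z} → Span s z → Span (n ℕ.+ s) (γ ^ n * z)
    span-γ^* zero    Sz = span-resp (sym (*-identityˡ _)) Sz
    span-γ^* (suc n) Sz = span-resp (sym (*-assoc γ _ _)) (span-γ* (span-γ^* n Sz))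

    γ^n∈span : ∀ n → Span n (γ ^ n)
    γ^n∈span n = span-resp (*-identityʳ _)
      (≡.subst (λ m → Span m (γ ^ n * 1#)) (ℕ.+-identityʳ n) (span-γ^* n (K⊆span 0 has1)))

    span-top : ∀ {m z} → Span (suc m) z → ∃ λ y → ∃ λ b → Span m y × K b × z ≈ y + γ ^ suc m * b
    span-top {zero} {z} (cons {a = a} {v} Ka (const {a = b} Kb v≈b) z≈a+γv) =
      a , b , const Ka refl , Kb , (begin
        z            ≈⟨ z≈a+γv ⟩
        a + γ * v    ≈⟨ +-congˡ (*-cong (sym (*-identityʳ γ)) v≈b) ⟩
        a + γ ^ 1 * b ∎)
    span-top {suc m} {z} (cons {a = a} {v} Ka Sv z≈a+γv) with span-top Sv
    ... | y , b , Sy , Kb , v≈y+γᵐb = a + γ * y , b , cons Ka Sy refl , Kb , (begin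
      z                                 ≈⟨ z≈a+γv ⟩
      a + γ * v                         ≈⟨ +-congˡ (*-congˡ v≈y+γᵐb) ⟩
      a + γ * (y + γ ^ suc m * b)       ≈⟨ +-congˡ (distribˡ γ y _) ⟩
      a + (γ * y + γ * (γ ^ suc m * b)) ≈⟨ +-assoc a _ _ ⟨
      (a + γ * y) + γ * (γ ^ suc m * b) ≈⟨ +-congˡ (*-assoc γ _ b) ⟨
      (a + γ * y) + γ ^ suc (suc m) * b ∎)

    sum-γ-shift : ∀ {n} (b : Fin n → F) → sum (λ i → b i * γ ^ suc (toℕ i)) ≈ γ * sum (λ i → b i * γ ^ toℕ i)
    sum-γ-shift b = trans (sum-cong-≋ (λ i → x∙yz≈y∙xz (b i) γ (γ ^ toℕ i)))
                          (sym (*-distribˡ-sum γ (λ i → b i * γ ^ toℕ i)))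

    powSpan⇒span : ∀ s {x} → FF.PowSpan R K γ s x → Span s x
    powSpan⇒span zero    (a , Ka , x≈Σ) = const (Ka Fin.zero) (trans x≈Σ (trans (+-identityʳ _) (*-identityʳ _)))
    powSpan⇒span (suc s) (a , Ka , x≈Σ) =
      cons (Ka Fin.zero) (powSpan⇒span s (a ∘ Fin.suc , Ka ∘ Fin.suc , refl))
           (trans x≈Σ (+-cong (*-identityʳ _) (sum-γ-shift (a ∘ Fin.suc))))

    span⇒powSpan : ∀ s {x} → Span s x → FF.PowSpan R K γ s x
    span⇒powSpan zero    (const {a = a} Ka x≈a) =
      (λ _ → a) , (λ _ → Ka) , trans x≈a (sym (trans (+-identityʳ _) (*-identityʳ _)))
    span⇒powSpan (suc s) (cons {a = a} Ka Sv x≈a+γv) with span⇒powSpan s Sv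
    ... | b , Kb , v≈Σ = coefficients , K-coefficients ,
      trans x≈a+γv (sym (+-cong (*-identityʳ a) (trans (sum-γ-shift b) (*-congˡ (sym v≈Σ)))))
      where
      coefficients : Fin (suc (suc s)) → F
      coefficients Fin.zero    = a
      coefficients (Fin.suc i) = b i
      K-coefficients : ∀ i → K (coefficients i)
      K-coefficients Fin.zero    = Ka
      K-coefficients (Fin.suc i) = Kb i

    γ-Stable : ℕ → Set (c ⊔ ℓ)
    γ-Stable j = ∀ {v} → Span j v → Span j (γ * v)

    γ-stable⇒subfield : ∀ {j} → γ-Stable j → FF.IsSubfield R (Span j)
    γ-stable⇒subfield {j} stable = record
      { resp = span-resp ; has0 = K⊆span j has0 ; has1 = K⊆span j has1 ; closed+ = span-+
      ; closed- = λ Sx → span-resp (-1*x≈-x _) (span-scale (closed- has1) Sx)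
      ; closed* = span-* j ; closedInv = span-inv }
      where
      span-* : ∀ s {x y} → Span s x → Span j y → Span j (x * y)
      span-* zero    (const Ka x≈a) Sy = span-resp (*-congʳ (sym x≈a)) (span-scale Ka Sy)
      span-* (suc s) {x} {y} (cons {a = a} {v} Ka Sv x≈a+γv) Sy =
        span-resp (begin
          a * y + γ * (v * y) ≈⟨ +-congˡ (*-assoc γ v y) ⟨
          a * y + (γ * v) * y ≈⟨ distribʳ y a (γ * v) ⟨
          (a + γ * v) * y     ≈⟨ *-congʳ x≈a+γv ⟨
          x * y               ∎) (span-+ (span-scale Ka Sy) (stable (span-* s Sv Sy)))
      span-^ : ∀ {x} r → Span j x → Span j (x ^ r)
      span-^ zero    _  = K⊆span j has1
      span-^ (suc r) Sx = span-* j Sx (span-^ r Sx)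
      span-inv : ∀ {x y} → Span j x → x * y ≈ 1# → Span j y
      span-inv {x} Sx xy≈1 with x ≟ 0#
      ... | yes x≈0 = ⊥-elim (1≉0 (trans (sym xy≈1) (trans (*-congʳ x≈0) (zeroˡ _))))
      ... | no  x≉0 with inverse-is-power x≉0
      ... | r , x*x^r≈1 = span-resp (inverse-unique x*x^r≈1 xy≈1) (span-^ r Sx)

    γ-stable⇒spanning : FF.GeneratesOver R K γ → ∀ {j} → γ-Stable j → ∀ z → Span j z
    γ-stable⇒spanning generates {j} stable = generates (Span j) (γ-stable⇒subfield stable)
      (λ _ → K⊆span j) (span-resp (*-identityʳ γ) (stable (K⊆span j has1)))

    leading-term⇒γ-stable : ∀ {l b} → K b → b ≉ 0# → Span l (γ ^ suc l * b) → γ-Stable l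
    leading-term⇒γ-stable {l} {b} Kb b≉0 Sγˡ⁺¹b Sv with *-inverse b≉0 | span-top (span-γ* Sv)
    ... | b⁻¹ , bb⁻¹≈1 | y , d , Sy , Kd , γv≈y+γˡ⁺¹d =
      span-resp (sym γv≈y+γˡ⁺¹d) (span-+ Sy (span-resp b⁻¹d*γˡ⁺¹b≈γˡ⁺¹d (span-scale (closed* (closedInv Kb bb⁻¹≈1) Kd) Sγˡ⁺¹b)))
      where
      b⁻¹d*γˡ⁺¹b≈γˡ⁺¹d : (b⁻¹ * d) * (γ ^ suc l * b) ≈ γ ^ suc l * d
      b⁻¹d*γˡ⁺¹b≈γˡ⁺¹d = begin
        (b⁻¹ * d) * (γ ^ suc l * b) ≈⟨ solve 4 (λ b⁻¹ d g b → (b⁻¹ :* d) :* (g :* b) := (b :* b⁻¹) :* (g :* d)) refl b⁻¹ d (γ ^ suc l) b ⟩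
        (b * b⁻¹) * (γ ^ suc l * d) ≈⟨ *-congʳ bb⁻¹≈1 ⟩
        1# * (γ ^ suc l * d)        ≈⟨ *-identityˡ _ ⟩
        γ ^ suc l * d               ∎

    module _ {l} (unstable : ¬ γ-Stable l) {x} (x-stabilizes : ∀ {w} → Span l w → Span l (x * w)) where

      -- If x = y + γ^(m+1) b with b ≠ 0, then x γ^(l−m) ∈ Span l puts γ^(l+1) b in Span l.
      lower-degree : ∀ {m} → m ℕ.< l → Span (suc m) x → Span m x
      lower-degree {m} m<l Sx with span-top Sx
      ... | y , b , Sy , Kb , x≈y+γᵐ⁺¹b with b ≟ 0#
      ... | yes b≈0 = span-resp (sym (trans x≈y+γᵐ⁺¹b (trans (+-congˡ (trans (*-congˡ b≈0) (zeroʳ _))) (+-identityʳ y)))) Sy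
      ... | no  b≉0 = ⊥-elim (unstable (leading-term⇒γ-stable Kb b≉0 (span-resp x*γᵈ-γᵈy≈γˡ⁺¹b
                        (span-− (x-stabilizes (span-mono (ℕ.m∸n≤m l m) (γ^n∈span d)))
                                (≡.subst (λ n → Span n (γ ^ d * y)) d+m≡l (span-γ^* d Sy))))))
        where
        d = l ℕ.∸ m
        d+m≡l : d ℕ.+ m ≡ l
        d+m≡l = ℕ.m∸n+n≡m (ℕ.<⇒≤ m<l)
        x*γᵈ-γᵈy≈γˡ⁺¹b : x * γ ^ d - γ ^ d * y ≈ γ ^ suc l * b
        x*γᵈ-γᵈy≈γˡ⁺¹b = begin
          x * γ ^ d - γ ^ d * y                                 ≈⟨ +-congʳ (*-congʳ x≈y+γᵐ⁺¹b) ⟩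
          (y + γ ^ suc m * b) * γ ^ d - γ ^ d * y               ≈⟨ +-congʳ (solve 4 (λ y g b G → (y :+ g :* b) :* G := G :* y :+ (G :* g) :* b) refl y (γ ^ suc m) b (γ ^ d)) ⟩
          (γ ^ d * y + (γ ^ d * γ ^ suc m) * b) - γ ^ d * y     ≈⟨ +-congʳ (+-congˡ (*-congʳ (sym (^-homo-* γ d (suc m))))) ⟩
          (γ ^ d * y + γ ^ (d ℕ.+ suc m) * b) - γ ^ d * y       ≈⟨ +-congʳ (+-congˡ (*-congʳ (^-congʳ γ (≡.trans (ℕ.+-suc d m) (≡.cong suc d+m≡l))))) ⟩
          (γ ^ d * y + γ ^ suc l * b) - γ ^ d * y               ≈⟨ xyx⁻¹≈y _ _ ⟩
          γ ^ suc l * b                                         ∎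

      descend : ∀ {m} → m ℕ.≤ l → Span m x → K x
      descend {zero}  _      (const Ka x≈a) = resp (sym x≈a) Ka
      descend {suc m} 1+m≤l  Sx             = descend (ℕ.<⇒≤ 1+m≤l) (lower-degree 1+m≤l Sx)

      stabilizer⊆K : K x
      stabilizer⊆K = descend ℕ.≤-refl (span-resp (*-identityʳ x) (x-stabilizes (K⊆span l has1)))

    stabilizer-of-unstable-span : ∀ {l} → ¬ γ-Stable l → ∀ x → FF.Stab R (FF.PowSpan R K γ l) x ⇔ K x
    stabilizer-of-unstable-span {l} unstable x = mk⇔ stab⇒K K⇒stab
      where
      stab⇒K : FF.Stab R (FF.PowSpan R K γ l) x → K x
      stab⇒K (inj₁ x≈0)               = resp (sym x≈0) has0
      stab⇒K (inj₂ (_ , x*U⊆U , _)) =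
        stabilizer⊆K unstable (λ {w} Sw → powSpan⇒span l (x*U⊆U w (span⇒powSpan l Sw)))
      K⇒stab : K x → FF.Stab R (FF.PowSpan R K γ l) x
      K⇒stab Kx with x ≟ 0#
      ... | yes x≈0 = inj₁ x≈0
      ... | no  x≉0 with *-inverse x≉0
      ... | x⁻¹ , xx⁻¹≈1 = inj₂ (x≉0 , (λ w U[w] → scale Kx U[w]) , λ w U[w] →
        x⁻¹ * w , scale (closedInv Kx xx⁻¹≈1) U[w] , sym (trans (sym (*-assoc x x⁻¹ w)) (trans (*-congʳ xx⁻¹≈1) (*-identityˡ w))))
        where
        scale : ∀ {a w} → K a → FF.PowSpan R K γ l w → FF.PowSpan R K γ l (a * w)
        scale Ka U[w] = span⇒powSpan l (span-scale Ka (powSpan⇒span l U[w]))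

    module _ (K? : Decidable K) where
      open Listing resp K?

      horner : ∀ s → Fin (size ℕ.^ suc s) → F
      horner zero    i = element (Fin.quotient 1 i)
      horner (suc s) i = element (Fin.quotient (size ℕ.^ suc s) i) + γ * horner s (Fin.remainder {size} (size ℕ.^ suc s) i)

      horner-onto : ∀ s {z} → Span s z → ∃ λ i → horner s i ≈ z
      horner-onto zero (const Ka z≈a) with element-complete Ka
      ... | i , eᵢ≈a = Fin.combine i Fin.zero ,
        trans (reflexive (≡.cong (element ∘ proj₁) (Fin.remQuot-combine {size} {1} i Fin.zero))) (trans eᵢ≈a (sym z≈a))
      horner-onto (suc s) (cons Ka Sv z≈a+γv) with element-complete Ka | horner-onto s Sv
      ... | i , eᵢ≈a | r , hᵣ≈v = Fin.combine i r ,
        trans (reflexive (≡.cong (λ (i , r) → element i + γ * horner s r) (Fin.remQuot-combine {size} {size ℕ.^ suc s} i r)))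
              (trans (+-cong eᵢ≈a (*-congˡ hᵣ≈v)) (sym z≈a+γv))

      γ-stable⇒N≤ : FF.GeneratesOver R K γ → ∀ {j} → γ-Stable j → N ℕ.≤ size ℕ.^ suc j
      γ-stable⇒N≤ generates {j} stable =
        surjective⇒N≤ (horner j) (λ z → horner-onto j (γ-stable⇒spanning generates stable z))

open import Data.Nat using (_*_; _^_; _<_; _∸_)

mainTheorem14 : ∀ {c ℓ} (R : CommutativeRing c ℓ) (q k t : ℕ) →
    FF.IsField R → FF.HasCard R (q ^ (k * t)) →
    (γ : CommutativeRing.Carrier R) → FF.GeneratesOver R (FF.Fqk R q k) γ →
    (l : ℕ) → l < t ∸ 1 →
    ∀ x → FF.Stab R (FF.PowSpan R (FF.Fqk R q k) γ l) x ⇔ FF.Fqk R q k x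
mainTheorem14 R q k t isField card γ generates l l<t∸1 =
  stabilizer-of-unstable-span (λ stable → ℕ.<⇒≱ Q^[1+l]<N (N≤Q^[1+l] stable))
  where
  open FiniteField R isField card
  1+l<t : suc l < t
  1+l<t = <∸1⇒suc< l<t∸1
  0<t : 0 < t
  0<t = ℕ.≤-trans (s≤s z≤n) (ℕ.<⇒≤ 1+l<t)
  Q = q ^ k
  Q^t≡N : Q ^ t ≡ q ^ (k * t)
  Q^t≡N = ℕ.^-*-assoc q k t
  2≤Q : 2 ℕ.≤ Q
  2≤Q = Q^t≡N⇒2≤Q 0<t Q^t≡N
  Q-is-p-power : ∃ λ E → Q ≡ p ℕ.^ E
  Q-is-p-power = Q^t≡N⇒Q≡p^E 0<t Q^t≡N
  open FixedField Q {proj₁ Q-is-p-power} (proj₂ Q-is-p-power)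
  open OverSubfield fixed-subfield γ
  N≤Q^[1+l] : γ-Stable l → q ^ (k * t) ℕ.≤ Q ^ suc l
  N≤Q^[1+l] stable = ℕ.≤-trans (γ-stable⇒N≤ fixed? generates stable) (ℕ.^-monoˡ-≤ (suc l) (fixed-count≤Q 2≤Q))
  Q^[1+l]<N : Q ^ suc l < q ^ (k * t)
  Q^[1+l]<N = ≡.subst (Q ^ suc l <_) Q^t≡N (ℕ.^-monoʳ-< Q 2≤Q 1+l<t)
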